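{- For every integer $n\ge 3$, $\beta(F_n)\ge \beta(Q_n)$.
   Context: $Q_n$ is the hypercube with vertex set $\{0,1\}^n$, vertices adjacent iff they differ in exactly one coordinate; for $u\in\{0,1\}^n$, $\overline{u}=u+(1,\dots,1)\pmod 2$. The folded hypercube $F_n$ has vertex set $\{\{u,\overline{u}\}:u\in\{0,1\}^n\}$, with $\{u,\overline u\}$ adjacent to $\{v,\overline v\}$ iff $uv$ or $u\overline v$ is an edge of $Q_n$; equivalently $d_{F_n}(\{u,\overline u\},\{v,\overline v\})=\min\{d_{Q_n}(u,v),n-d_{Q_n}(u,v)\}$. For a graph $G$, a set $S\subseteq V(G)$ is resolving if for all distinct $u,v$ some $y\in S$ has $d_G(u,y)\neq d_G(v,y)$, and $\beta(G)$ is the minimum size of a resolving set. -}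

module Defs where

open import Data.Bool using (Bool; true; false; not)
open import Data.Nat using (ℕ; zero; suc; _+_; _∸_; _⊓_)
open import Data.Vec using (Vec; []; _∷_; map)
open import Data.List using (List)
open import Data.List.Membership.Propositional using (_∈_)
open import Data.Product using (Σ; ∃-syntax; _×_)
open import Data.Sum using (_⊎_)
open import Relation.Nullary using (¬_)
open import Relation.Binary.PropositionalEquality using (_≡_)

-- Vertices of the hypercube Q_n: binary words of length n.
Word : ℕ → Set
Word n = Vec Bool n

hamming : ∀ {n} → Word n → Word n → ℕ
hamming [] [] = 0
hamming (true ∷ u) (true ∷ v) = hamming u v
hamming (false ∷ u) (false ∷ v) = hamming u v
hamming (true ∷ u) (false ∷ v) = suc (hamming u v)
hamming (false ∷ u) (true ∷ v) = suc (hamming u v)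

distQ : ∀ {n} → Word n → Word n → ℕ
distQ = hamming

compl : ∀ {n} → Word n → Word n
compl = map not

-- A vertex {u, ū} of F_n is represented by either of its elements u, ū.
-- Two representatives denote the same vertex of F_n iff they are equal or complementary.
SameF : ∀ {n} → Word n → Word n → Set
SameF u v = u ≡ v ⊎ u ≡ compl v

-- d_{F_n}({u,ū},{v,v̄}) = min { d_{Q_n}(u,v), n − d_{Q_n}(u,v) }  (independent of representatives)
distF : ∀ n → Word n → Word n → ℕ
distF n u v = distQ u v ⊓ (n ∸ distQ u v)

ResolvingQ : ∀ n → List (Word n) → Set
ResolvingQ n S = ∀ (u v : Word n) → ¬ (u ≡ v) →
  ∃[ y ] (y ∈ S × ¬ (distQ u y ≡ distQ v y))

ResolvingF : ∀ n → List (Word n) → Set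
ResolvingF n S = ∀ (u v : Word n) → ¬ SameF u v →
  ∃[ y ] (y ∈ S × ¬ (distF n u y ≡ distF n v y))

-- The distance in F_n is a function of the distance in Q_n, so a resolving set S of F_n
-- separates every pair of vertices of Q_n that are not complementary. For a complementary
-- pair {v, v̄} it suffices to find y ∈ S with d(v, y) ≠ n/2. Flip the first, respectively
-- the second, coordinate of v; for n ≥ 3 the two words are distinct vertices of F_n, so
-- some y ∈ S separates them in F_n. If d(v, y) = h with n = 2h, both flipped words lie at
-- Hamming distance h ± 1 from y, hence at F_n-distance h − 1: a contradiction. So S
-- itself resolves Q_n.
module Submission where

open import Defs
open import Data.Bool using (Bool; true; false; not)
open import Data.Bool.Properties using (not-¬) renaming (_≟_ to _≟ᵇ_)
open import Data.Fin using (Fin; zero; suc)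
open import Data.List using (List; length)
open import Data.List.Membership.Propositional using (_∈_)
open import Data.List.Relation.Unary.AllPairs as AllPairs using (AllPairs)
open import Data.List.Relation.Unary.Unique.Propositional using (Unique)
open import Data.Nat using (ℕ; zero; suc; pred; _+_; _∸_; _⊓_; _≤_; s≤s)
open import Data.Nat.Properties
  using (≤-refl; ≤-trans; n≤1+n; m≤m+n; pred[n]≤n; +-suc; m+n∸n≡m; +-∸-assoc;
         pred[m∸n]≡m∸[1+n]; m≤n⇒m⊓n≡m; m≥n⇒m⊓n≡n)
open import Data.Product using (∃-syntax; _×_; _,_)
open import Data.Sum using (_⊎_; inj₁; inj₂)
open import Data.Vec using (_∷_; []; head; lookup; updateAt)
open import Data.Vec.Properties using (≡-dec)
open import Relation.Nullary using (¬_; yes; no)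
open import Relation.Binary.PropositionalEquality using (_≡_; refl; sym; trans; cong; subst)
open Relation.Binary.PropositionalEquality.≡-Reasoning

flip : ∀ {n} → Fin n → Word n → Word n
flip i u = updateAt u i not

hamming-compl+hamming : ∀ {n} (v y : Word n) → hamming (compl v) y + hamming v y ≡ n
hamming-compl+hamming []          []          = refl
hamming-compl+hamming (true ∷ v)  (true ∷ y)  = cong suc (hamming-compl+hamming v y)
hamming-compl+hamming (true ∷ v)  (false ∷ y) = trans (+-suc _ _) (cong suc (hamming-compl+hamming v y))
hamming-compl+hamming (false ∷ v) (true ∷ y)  = trans (+-suc _ _) (cong suc (hamming-compl+hamming v y))
hamming-compl+hamming (false ∷ v) (false ∷ y) = cong suc (hamming-compl+hamming v y)

OffByOne : ℕ → ℕ → Set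
OffByOne d h = d ≡ suc h ⊎ suc d ≡ h

offByOne-suc : ∀ {d h} → OffByOne d h → OffByOne (suc d) (suc h)
offByOne-suc (inj₁ d≡1+h) = inj₁ (cong suc d≡1+h)
offByOne-suc (inj₂ 1+d≡h) = inj₂ (cong suc 1+d≡h)

hamming-flip : ∀ {n} (i : Fin n) (u y : Word n) → OffByOne (hamming (flip i u) y) (hamming u y)
hamming-flip zero    (true ∷ u)  (true ∷ y)  = inj₁ refl
hamming-flip zero    (true ∷ u)  (false ∷ y) = inj₂ refl
hamming-flip zero    (false ∷ u) (true ∷ y)  = inj₂ refl
hamming-flip zero    (false ∷ u) (false ∷ y) = inj₁ refl
hamming-flip (suc i) (true ∷ u)  (true ∷ y)  = hamming-flip i u y
hamming-flip (suc i) (true ∷ u)  (false ∷ y) = offByOne-suc (hamming-flip i u y)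
hamming-flip (suc i) (false ∷ u) (true ∷ y)  = offByOne-suc (hamming-flip i u y)
hamming-flip (suc i) (false ∷ u) (false ∷ y) = hamming-flip i u y

⊓-∸-offByOne : ∀ {n d h} → h + h ≡ n → OffByOne d h → d ⊓ (n ∸ d) ≡ pred h
⊓-∸-offByOne {h = h} refl (inj₁ refl) = begin
  suc h ⊓ (h + h ∸ suc h)   ≡⟨ cong (suc h ⊓_) (sym (pred[m∸n]≡m∸[1+n] (h + h) h)) ⟩
  suc h ⊓ pred (h + h ∸ h)  ≡⟨ cong (λ k → suc h ⊓ pred k) (m+n∸n≡m h h) ⟩
  suc h ⊓ pred h            ≡⟨ m≥n⇒m⊓n≡n (≤-trans pred[n]≤n (n≤1+n h)) ⟩
  pred h                    ∎
⊓-∸-offByOne {d = d} refl (inj₂ refl) = m≤n⇒m⊓n≡m d≤2+2d∸d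
  where
  d≤2+2d∸d : d ≤ suc d + suc d ∸ d
  d≤2+2d∸d = subst (d ≤_) (sym (+-∸-assoc (suc d) (n≤1+n d)))
                   (≤-trans (n≤1+n d) (m≤m+n (suc d) (suc d ∸ d)))

distF-flip-of-balanced : ∀ {n} (i : Fin n) (v y : Word n) → distQ (compl v) y ≡ distQ v y →
  distF n (flip i v) y ≡ pred (distQ v y)
distF-flip-of-balanced {n} i v y balanced = ⊓-∸-offByOne h+h≡n (hamming-flip i v y)
  where
  h+h≡n : hamming v y + hamming v y ≡ n
  h+h≡n = trans (cong (_+ hamming v y) (sym balanced)) (hamming-compl+hamming v y)

flip₀≢flip₁ : ∀ {m} (v : Word (3 + m)) → ¬ SameF (flip zero v) (flip (suc zero) v)
flip₀≢flip₁ (x₀ ∷ x₁ ∷ x₂ ∷ r) (inj₁ eq) = not-¬ refl (sym (cong head eq))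
flip₀≢flip₁ (x₀ ∷ x₁ ∷ x₂ ∷ r) (inj₂ eq) = not-¬ refl (cong (λ w → lookup w (suc (suc zero))) eq)

resolvingF⇒resolves-compl : ∀ {m} {S : List (Word (3 + m))} → ResolvingF (3 + m) S →
  ∀ v → ∃[ y ] (y ∈ S × ¬ (distQ (compl v) y ≡ distQ v y))
resolvingF⇒resolves-compl res v with res (flip zero v) (flip (suc zero) v) (flip₀≢flip₁ v)
... | y , y∈S , separates = y , y∈S , λ balanced → separates
  (trans (distF-flip-of-balanced zero v y balanced) (sym (distF-flip-of-balanced (suc zero) v y balanced)))

resolvingF⇒resolvingQ : ∀ {m} {S : List (Word (3 + m))} → ResolvingF (3 + m) S → ResolvingQ (3 + m) S
resolvingF⇒resolvingQ {m} res u v u≢v with ≡-dec _≟ᵇ_ u (compl v)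
... | yes refl = resolvingF⇒resolves-compl res v
... | no u≢v̄ with res u v (λ { (inj₁ u≡v) → u≢v u≡v ; (inj₂ u≡v̄) → u≢v̄ u≡v̄ })
...   | y , y∈S , separates = y , y∈S , λ same → separates (cong (λ d → d ⊓ (3 + m ∸ d)) same)

lemma5 : ∀ (n : ℕ) → 3 ≤ n →
    ∀ (S : List (Word n)) → AllPairs (λ a b → ¬ SameF a b) S → ResolvingF n S →
    ∃[ T ] (Unique T × ResolvingQ n T × length T ≤ length S)
lemma5 (suc (suc (suc m))) (s≤s (s≤s (s≤s _))) S distinctF res =
  S , AllPairs.map (λ a≉b a≡b → a≉b (inj₁ a≡b)) distinctF , resolvingF⇒resolvingQ res , ≤-refl
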